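{- Let $G$ be a graph on $n$ vertices with minimum degree $\delta(G) \geq 3n/4$, whose edges are coloured red and blue. Then the vertex set of $G$ can be covered by a red component and a blue component, i.e. there exist a red component $R$ and a blue component $B$ with $R \cup B = V(G)$.
   Context: A red component is the vertex set of a connected component of the spanning subgraph of $G$ with vertex set $V(G)$ and edge set the red edges of $G$ (a vertex incident with no red edges forms a red component by itself); blue components are defined analogously. -}

module Defs where

open import Level using (0ℓ)
open import Data.Nat using (ℕ; _*_; _≤_)
open import Data.Fin using (Fin)
open import Data.List using (length; filter; allFin)
open import Data.Empty using (⊥)
open import Relation.Nullary using (¬_)
open import Relation.Unary using (Decidable)
open import Relation.Binary.PropositionalEquality using (_≡_)

record Graph (n : ℕ) : Set₁ where
  field
    Adj     : Fin n → Fin n → Set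
    adj?    : (u v : Fin n) → Relation.Nullary.Dec (Adj u v)
    sym     : ∀ {u v} → Adj u v → Adj v u
    irrefl  : ∀ {u} → ¬ Adj u u

  degree : Fin n → ℕ
  degree v = length (filter (adj? v) (allFin n))

open Graph public

data Colour : Set where
  red blue : Colour

record Colouring {n : ℕ} (G : Graph n) : Set where
  field
    colour     : ∀ {u v} → Adj G u v → Colour
    colour-sym : ∀ {u v} (e : Adj G u v) → colour (sym G e) ≡ colour e

open Colouring public

data Conn {n : ℕ} {G : Graph n} (χ : Colouring G) (c : Colour) (u : Fin n) : Fin n → Set where
  here : Conn χ c u u
  step : ∀ {v w} → Conn χ c u v → (e : Adj G v w) → colour χ e ≡ c → Conn χ c u w

Component : {n : ℕ} {G : Graph n} (χ : Colouring G) (c : Colour) (x : Fin n) → Fin n → Set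
Component χ c x v = Conn χ c x v

IsComponent : {n : ℕ} {G : Graph n} (χ : Colouring G) (c : Colour) → (Fin n → Set) → Set
IsComponent {n} χ c S = Data.Product.∃ λ (x : Fin n) → ∀ v → (S v → Component χ c x v) Data.Product.× (Component χ c x v → S v)
  where import Data.Product

-- Fix a vertex u. If every vertex is joined to u by a monochromatic walk of
-- length at most 3, the red and the blue component of u cover V(G). Otherwise
-- take y beyond that distance. Then y ≁ u, so u and y have more than n/2 common
-- neighbours, and each common neighbour z sees u and y in different colours.
-- The common neighbours with u–z red split off from those with u–z blue, and
-- the two classes are mutually non-adjacent (an edge between them would close
-- a monochromatic u–y walk of length 3). If both classes were non-empty, a
-- vertex of each class would have its ≥ 3n/4 neighbours outside the other
-- class, making both classes of size ≤ n/4 — too few. So one class S carries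
-- all common neighbours, |S| > n/2, and every vertex w has a neighbour z in S;
-- the colour of wz then puts w in the component of u or of y with that colour.
module Submission where

open import Level using (Level; 0ℓ)
open import Data.Nat using (ℕ; zero; suc; _+_; _*_; _≤_; _<_)
open import Data.Nat.Properties
open import Data.Nat.Tactic.RingSolver using (solve)
open import Data.Fin using (Fin; zero)
import Data.Fin.Properties as Fin
open import Data.List using (List; []; _∷_; length; filter; allFin)
open import Data.List.Properties using (length-filter; filter-notAll; filter-none; length-tabulate)
open import Data.List.Membership.Propositional.Properties using (∈-allFin)
open import Data.List.Relation.Binary.Sublist.Propositional.Properties using (filter⁺; length-mono-≤)
open import Data.List.Relation.Binary.Sublist.Propositional using (⊆-refl)
import Data.List.Relation.Unary.All as All
import Data.List.Relation.Unary.Any as Any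
open import Data.Maybe using (Maybe; just; nothing)
import Data.Maybe.Properties as Maybe
open import Data.Product using (Σ; ∃; _×_; _,_; proj₂)
open import Data.Sum using (_⊎_; inj₁; inj₂; [_,_]′)
import Data.Sum as Sum
open import Function using (id; _∘_)
open import Relation.Nullary using (¬_; Dec; yes; no; contradiction)
open import Relation.Nullary.Decidable using (_⊎-dec_; _×-dec_)
open import Relation.Unary using (Pred; Decidable; _⊆_; _∪_; _∩_; _⊥_; _≬_; Empty; Satisfiable)
open import Relation.Unary.Properties using (_∪?_; _∩?_)
open import Relation.Binary.PropositionalEquality
open import Defs hiding (sym)
open Defs.Graph using () renaming (sym to Adj-sym)

private
  variable
    a p q : Level
    A : Set a
    n k : ℕ

more-than-half : ∀ n a b c → a + b < n + c → 3 * n ≤ 4 * a → 3 * n ≤ 4 * b → n < 2 * c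
more-than-half n a b c a+b<n+c 3n≤4a 3n≤4b =
  *-cancelˡ-< 2 n (2 * c) (+-cancelˡ-< (4 * n) (2 * n) (2 * (2 * c)) (begin-strict
    4 * n + 2 * n       ≡⟨ solve (n ∷ []) ⟩
    3 * n + 3 * n       ≤⟨ +-mono-≤ 3n≤4a 3n≤4b ⟩
    4 * a + 4 * b       ≡⟨ *-distribˡ-+ 4 a b ⟨
    4 * (a + b)         <⟨ *-monoʳ-< 4 a+b<n+c ⟩
    4 * (n + c)         ≡⟨ solve (n ∷ c ∷ []) ⟩
    4 * n + 2 * (2 * c) ∎))
  where open ≤-Reasoning

quarter-bound : ∀ n k m → k + m ≤ n → 3 * n ≤ 4 * k → 4 * m ≤ n
quarter-bound n k m k+m≤n 3n≤4k = +-cancelʳ-≤ (3 * n) (4 * m) n (begin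
  4 * m + 3 * n ≤⟨ +-monoʳ-≤ (4 * m) 3n≤4k ⟩
  4 * m + 4 * k ≡⟨ *-distribˡ-+ 4 m k ⟨
  4 * (m + k)   ≤⟨ *-monoʳ-≤ 4 (≤-trans (≤-reflexive (+-comm m k)) k+m≤n) ⟩
  n + 3 * n     ∎)
  where open ≤-Reasoning

sum-of-quarters : ∀ n c p q → c ≤ p + q → 4 * p ≤ n → 4 * q ≤ n → 2 * c ≤ n
sum-of-quarters n c p q c≤p+q 4p≤n 4q≤n = *-cancelˡ-≤ 2 (begin
  2 * (2 * c)       ≤⟨ *-monoʳ-≤ 2 (*-monoʳ-≤ 2 c≤p+q) ⟩
  2 * (2 * (p + q)) ≡⟨ solve (p ∷ q ∷ []) ⟩
  4 * p + 4 * q     ≤⟨ +-mono-≤ 4p≤n 4q≤n ⟩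
  n + n             ≡⟨ solve (n ∷ []) ⟩
  2 * n             ∎)
  where open ≤-Reasoning

more-than-all-but-quarter : ∀ n d s → n < 2 * s → 3 * n ≤ 4 * d → n < d + s
more-than-all-but-quarter n d s n<2s 3n≤4d = *-cancelˡ-< 4 n (d + s) (begin-strict
  4 * n         ≡⟨ +-comm n (3 * n) ⟩
  3 * n + n     <⟨ +-mono-≤-< 3n≤4d n<2s ⟩
  4 * d + 2 * s ≤⟨ +-monoʳ-≤ (4 * d) (*-monoˡ-≤ s {2} {4} (m≤m+n 2 2)) ⟩
  4 * d + 4 * s ≡⟨ *-distribˡ-+ 4 d s ⟨
  4 * (d + s)   ∎)
  where open ≤-Reasoning

length-filter-∪+∩ : {P : Pred A p} {Q : Pred A q} (P? : Decidable P) (Q? : Decidable Q) (xs : List A) →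
  length (filter (P? ∪? Q?) xs) + length (filter (P? ∩? Q?) xs) ≡ length (filter P? xs) + length (filter Q? xs)
length-filter-∪+∩ P? Q? [] = refl
length-filter-∪+∩ P? Q? (x ∷ xs) with ih ← length-filter-∪+∩ P? Q? xs | P? x | Q? x
... | yes _ | yes _ = cong suc (trans (+-suc _ _) (trans (cong suc ih) (sym (+-suc _ _))))
... | yes _ | no  _ = cong suc ih
... | no  _ | yes _ = trans (cong suc ih) (sym (+-suc _ _))
... | no  _ | no  _ = ih

count : {P : Pred (Fin n) 0ℓ} → Decidable P → ℕ
count {n} P? = length (filter P? (allFin n))

module _ {P : Pred (Fin n) 0ℓ} (P? : Decidable P) where

  count≤n : count P? ≤ n
  count≤n = subst (count P? ≤_) (length-tabulate id) (length-filter P? (allFin n))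

  count<n : ∀ {x} → ¬ P x → count P? < n
  count<n {x} ¬Px = subst (count P? <_) (length-tabulate id)
    (filter-notAll P? (allFin n) (Any.map (λ { refl → ¬Px }) (∈-allFin x)))

  count-empty : Empty P → count P? ≡ 0
  count-empty empty = cong length (filter-none P? (All.universal empty (allFin n)))

  count-satisfiable : 0 < count P? → Satisfiable P
  count-satisfiable 0<count with Fin.any? P?
  ... | yes sat  = sat
  ... | no ¬sat = contradiction (count-empty (λ x Px → ¬sat (x , Px))) (≢-sym (<⇒≢ 0<count))

count-mono : {P Q : Pred (Fin n) 0ℓ} (P? : Decidable P) (Q? : Decidable Q) → P ⊆ Q → count P? ≤ count Q?
count-mono P? Q? P⊆Q = length-mono-≤ (filter⁺ P? Q? (λ { refl → P⊆Q }) (⊆-refl {x = allFin _}))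

module _ {P Q : Pred (Fin n) 0ℓ} (P? : Decidable P) (Q? : Decidable Q) where

  count∪+count∩ : count (P? ∪? Q?) + count (P? ∩? Q?) ≡ count P? + count Q?
  count∪+count∩ = length-filter-∪+∩ P? Q? (allFin n)

  count+count<n+count∩ : ∀ {x} → ¬ P x → ¬ Q x → count P? + count Q? < n + count (P? ∩? Q?)
  count+count<n+count∩ ¬Px ¬Qx = begin-strict
    count P? + count Q?               ≡⟨ count∪+count∩ ⟨
    count (P? ∪? Q?) + count (P? ∩? Q?) <⟨ +-monoˡ-< _ (count<n (P? ∪? Q?) [ ¬Px , ¬Qx ]′) ⟩
    n + count (P? ∩? Q?)              ∎
    where open ≤-Reasoning

  n<count+count⇒≬ : n < count P? + count Q? → P ≬ Q
  n<count+count⇒≬ n<count+count = count-satisfiable (P? ∩? Q?) (+-cancelˡ-< n 0 _ (begin-strict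
    n + 0                             ≡⟨ +-identityʳ n ⟩
    n                                 <⟨ n<count+count ⟩
    count P? + count Q?               ≡⟨ count∪+count∩ ⟨
    count (P? ∪? Q?) + count (P? ∩? Q?) ≤⟨ +-monoˡ-≤ _ (count≤n (P? ∪? Q?)) ⟩
    n + count (P? ∩? Q?)              ∎))
    where open ≤-Reasoning

  count+count≤n : P ⊥ Q → count P? + count Q? ≤ n
  count+count≤n P⊥Q = ≮⇒≥ (λ n<count+count → P⊥Q (proj₂ (n<count+count⇒≬ n<count+count)))

  count≤count+count : {R : Pred (Fin n) 0ℓ} (R? : Decidable R) → R ⊆ P ∪ Q → count R? ≤ count P? + count Q?
  count≤count+count R? R⊆P∪Q = begin
    count R?                          ≤⟨ count-mono R? (P? ∪? Q?) R⊆P∪Q ⟩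
    count (P? ∪? Q?)                  ≤⟨ m≤m+n _ _ ⟩
    count (P? ∪? Q?) + count (P? ∩? Q?) ≡⟨ count∪+count∩ ⟩
    count P? + count Q?               ∎
    where open ≤-Reasoning

other : Colour → Colour
other red  = blue
other blue = red

≡-or-≡other : ∀ c c′ → c′ ≡ c ⊎ c′ ≡ other c
≡-or-≡other red  red  = inj₁ refl
≡-or-≡other red  blue = inj₂ refl
≡-or-≡other blue red  = inj₂ refl
≡-or-≡other blue blue = inj₁ refl

_≟ᶜ_ : (c c′ : Colour) → Dec (c ≡ c′)
red  ≟ᶜ red  = yes refl
red  ≟ᶜ blue = no λ ()
blue ≟ᶜ red  = no λ ()
blue ≟ᶜ blue = yes refl

CoveredByComponents : {G : Graph n} → Colouring G → Set₁
CoveredByComponents {n} χ = Σ (Fin n → Set) λ R → Σ (Fin n → Set) λ B →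
  IsComponent χ red R × IsComponent χ blue B × (∀ v → R v ⊎ B v)

module _ {G : Graph n} (χ : Colouring G) where

  components-cover : ∀ {x y} → (∀ v → Conn χ red x v ⊎ Conn χ blue y v) → CoveredByComponents χ
  components-cover {x} {y} cover =
    Conn χ red x , Conn χ blue y , (x , λ _ → id , id) , (y , λ _ → id , id) , cover

  -- Adj is proof-relevant and parallel witnesses may carry different colours,
  -- so only the witness chosen by adj? is consulted; this keeps Joined decidable.
  colourOf : Fin n → Fin n → Maybe Colour
  colourOf u v with adj? G u v
  ... | yes e = just (colour χ e)
  ... | no  _ = nothing

  Joined : Colour → Fin n → Fin n → Set
  Joined c u v = colourOf u v ≡ just c ⊎ colourOf v u ≡ just c

  joined? : ∀ c u v → Dec (Joined c u v)
  joined? c u v = Maybe.≡-dec _≟ᶜ_ (colourOf u v) (just c) ⊎-dec Maybe.≡-dec _≟ᶜ_ (colourOf v u) (just c)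

  Joined-sym : ∀ {c u v} → Joined c u v → Joined c v u
  Joined-sym = Sum.swap

  adj⇒joined : ∀ {u v} → Adj G u v → ∃ λ c → Joined c u v
  adj⇒joined {u} {v} e with adj? G u v
  ... | yes e′ = colour χ e′ , inj₁ refl
  ... | no ¬e  = contradiction e ¬e

  canonical-edge : ∀ {c u v} → colourOf u v ≡ just c → Σ (Adj G u v) λ e → colour χ e ≡ c
  canonical-edge {u = u} {v} eq with adj? G u v
  canonical-edge refl | yes e = e , refl

  extend : ∀ {c x u v} → Conn χ c x u → Joined c u v → Conn χ c x v
  extend walk (inj₁ uv) with e , refl ← canonical-edge uv = step walk e refl
  extend walk (inj₂ vu) with e , refl ← canonical-edge vu = step walk (Adj-sym G e) (colour-sym χ e)

  Reach : ℕ → Colour → Fin n → Fin n → Set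
  Reach zero    c x y = x ≡ y
  Reach (suc k) c x y = Reach k c x y ⊎ ∃ λ z → Reach k c x z × Joined c z y

  reach? : ∀ k c x → Decidable (Reach k c x)
  reach? zero    c x y = x Fin.≟ y
  reach? (suc k) c x y = reach? k c x y ⊎-dec Fin.any? λ z → reach? k c x z ×-dec joined? c z y

  infixl 5 _▸_
  _▸_ : ∀ {c x z y} → Reach k c x z → Joined c z y → Reach (suc k) c x y
  walk ▸ j = inj₂ (_ , walk , j)

  reach⇒conn : ∀ k {c x y} → Reach k c x y → Conn χ c x y
  reach⇒conn zero    refl                  = here
  reach⇒conn (suc k) (inj₁ walk)           = reach⇒conn k walk
  reach⇒conn (suc k) (inj₂ (_ , walk , j)) = extend (reach⇒conn k walk) j

  module Far (dense : ∀ v → 3 * n ≤ 4 * degree G v) (u y : Fin n) (far : ∀ c → ¬ Reach 3 c u y) where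

    no-walk₁ : ∀ {c} → ¬ Joined c u y
    no-walk₁ j = far _ (inj₁ (inj₁ (refl ▸ j)))

    no-walk₂ : ∀ {c z} → Joined c u z → ¬ Joined c z y
    no-walk₂ j₁ j₂ = far _ (inj₁ (refl ▸ j₁ ▸ j₂))

    no-walk₃ : ∀ {c z z′} → Joined c u z → Joined c z z′ → ¬ Joined c z′ y
    no-walk₃ j₁ j₂ j₃ = far _ (refl ▸ j₁ ▸ j₂ ▸ j₃)

    y≁u : ¬ Adj G y u
    y≁u e = no-walk₁ (Joined-sym (proj₂ (adj⇒joined e)))

    Switch : Colour → Pred (Fin n) 0ℓ
    Switch c z = Joined c u z × Joined (other c) z y

    switch? : ∀ c → Decidable (Switch c)
    switch? c z = joined? c u z ×-dec joined? (other c) z y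

    common? : Decidable (Adj G u ∩ Adj G y)
    common? = adj? G u ∩? adj? G y

    common⊆switches : Adj G u ∩ Adj G y ⊆ Switch red ∪ Switch blue
    common⊆switches (uz , yz) with adj⇒joined uz | adj⇒joined yz
    ... | red  , j₁ | red  , j₂ = contradiction (Joined-sym j₂) (no-walk₂ j₁)
    ... | red  , j₁ | blue , j₂ = inj₁ (j₁ , Joined-sym j₂)
    ... | blue , j₁ | red  , j₂ = inj₂ (j₁ , Joined-sym j₂)
    ... | blue , j₁ | blue , j₂ = contradiction (Joined-sym j₂) (no-walk₂ j₁)

    switches-nonadjacent : ∀ {z z′} → Switch red z → Switch blue z′ → ¬ Adj G z z′
    switches-nonadjacent (uz , zy) (uz′ , z′y) e with adj⇒joined e
    ... | red  , j = no-walk₃ uz j z′y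
    ... | blue , j = no-walk₃ uz′ (Joined-sym j) zy

    many-common : n < 2 * count common?
    many-common = more-than-half n (degree G u) (degree G y) (count common?)
      (count+count<n+count∩ (adj? G u) (adj? G y) (irrefl G) y≁u) (dense u) (dense y)

    common≤switches : count common? ≤ count (switch? red) + count (switch? blue)
    common≤switches = count≤count+count (switch? red) (switch? blue) common? common⊆switches

    small-blue : Satisfiable (Switch red) → 4 * count (switch? blue) ≤ n
    small-blue (z , s) = quarter-bound n (degree G z) (count (switch? blue))
      (count+count≤n (adj? G z) (switch? blue) (λ (e , s′) → switches-nonadjacent s s′ e)) (dense z)

    small-red : Satisfiable (Switch blue) → 4 * count (switch? red) ≤ n
    small-red (z′ , s′) = quarter-bound n (degree G z′) (count (switch? red))
      (count+count≤n (adj? G z′) (switch? red) (λ (e , s) → switches-nonadjacent s s′ (Adj-sym G e))) (dense z′)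

    neighbour-of-switch-covered : ∀ c {w z} → Adj G w z → Switch c z → Conn χ c u w ⊎ Conn χ (other c) y w
    neighbour-of-switch-covered c wz (uz , zy) with c′ , wz′ ← adj⇒joined wz | ≡-or-≡other c c′
    ... | inj₁ refl = inj₁ (extend (extend here uz) (Joined-sym wz′))
    ... | inj₂ refl = inj₂ (extend (extend here (Joined-sym zy)) (Joined-sym wz′))

    switch-covers : ∀ c → count common? ≤ count (switch? c) → ∀ w → Conn χ c u w ⊎ Conn χ (other c) y w
    switch-covers c common≤switch w =
      let _ , wz , s = n<count+count⇒≬ (adj? G w) (switch? c) n<degree+switch
      in neighbour-of-switch-covered c wz s
      where
      n<degree+switch : n < degree G w + count (switch? c)
      n<degree+switch = more-than-all-but-quarter n (degree G w) (count (switch? c))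
        (<-≤-trans many-common (*-monoʳ-≤ 2 common≤switch)) (dense w)

    common≤only-switch : ∀ c → Empty (Switch (other c)) → count common? ≤ count (switch? c)
    common≤only-switch red  empty = ≤-trans common≤switches
      (≤-reflexive (trans (cong (count (switch? red) +_) (count-empty (switch? blue) empty)) (+-identityʳ _)))
    common≤only-switch blue empty = ≤-trans common≤switches
      (≤-reflexive (cong (_+ count (switch? blue)) (count-empty (switch? red) empty)))

    covered : CoveredByComponents χ
    covered with Fin.any? (switch? red) | Fin.any? (switch? blue)
    ... | yes red-class | yes blue-class = contradiction
      (sum-of-quarters n (count common?) (count (switch? red)) (count (switch? blue))
        common≤switches (small-red blue-class) (small-blue red-class))
      (<⇒≱ many-common)
    ... | _ | no no-blue = components-cover (switch-covers red (common≤only-switch red λ z s → no-blue (z , s)))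
    ... | no no-red | _  = components-cover (Sum.swap ∘ switch-covers blue (common≤only-switch blue λ z s → no-red (z , s)))

  Near : Fin n → Fin n → Set
  Near u y = Reach 3 red u y ⊎ Reach 3 blue u y

  near? : ∀ u → Decidable (Near u)
  near? u y = reach? 3 red u y ⊎-dec reach? 3 blue u y

  covered-from : (∀ v → 3 * n ≤ 4 * degree G v) → Fin n → CoveredByComponents χ
  covered-from dense u with Fin.all? (near? u)
  ... | yes near = components-cover (Sum.map (reach⇒conn 3) (reach⇒conn 3) ∘ near)
  ... | no ¬near =
    let y , far = Fin.¬∀⟶∃¬ n (Near u) (near? u) ¬near
    in Far.covered dense u y λ { red → far ∘ inj₁ ; blue → far ∘ inj₂ }

lemma3p2 : (n : ℕ) → 1 ≤ n → (G : Graph n) → (∀ v → 3 * n ≤ 4 * degree G v) →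
    (χ : Colouring G) →
    Σ (Fin n → Set) λ R → Σ (Fin n → Set) λ B →
      IsComponent χ red R × IsComponent χ blue B × (∀ v → R v ⊎ B v)
lemma3p2 (suc m) _ G dense χ = covered-from χ dense zero
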